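{- Let $b^{(\le k)}(n)$ and $b^{(\ge k)}(n)$ denote the number of Arndt compositions of $n$ whose last part is at most $k$, respectively at least $k$. For integers $k\ge 1$ and $n\ge 2k+2$, $$b^{(\leq k)}(n)=F_{n}- F_{n-k-1} - F_{n-2k-2} \quad \text{and} \quad b^{(\geq k)}(n)=F_{n-k}+ F_{n-2k},$$ where $F_n$ are the Fibonacci numbers ($F_0=0,F_1=1,F_n=F_{n-1}+F_{n-2}$).
   Context: A composition of $n$ is a finite sequence $(\sigma_1,\dots,\sigma_\ell)$ of positive integers summing to $n$. An Arndt composition is one with $\sigma_{2i-1}>\sigma_{2i}$ for every positive integer $i$ with $2i\le\ell$. The last part of a nonempty composition is $\sigma_\ell$. -}

module Defs where

open import Data.Nat using (ℕ; zero; suc; _+_; _∸_; _≤_; _<_; _≤ᵇ_; _<ᵇ_)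
open import Data.Bool using (Bool; true; false; _∧_)
open import Data.List using (List; []; _∷_; map; concatMap; filter; length; last; upTo)
open import Data.Nat.ListAction using (sum)
open import Data.List.Relation.Unary.All using (All)
open import Data.Maybe using (Maybe; just; nothing)
open import Data.Product using (_×_)
open import Relation.Binary.PropositionalEquality using (_≡_)
open import Relation.Nullary.Decidable using (Dec)
open import Relation.Unary using (Pred; Decidable)

F : ℕ → ℕ
F zero = 0
F (suc zero) = 1
F (suc (suc n)) = F (suc n) + F n

IsComposition : ℕ → List ℕ → Set
IsComposition n σ = All (λ x → 1 ≤ x) σ × sum σ ≡ n

compsAux : ℕ → List (List ℕ)
compsAux n = go n n
  where
  -- go fuel m : all compositions of m, given fuel ≥ m
  go : ℕ → ℕ → List (List ℕ)
  go _ zero = [] ∷ []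
  go zero (suc _) = []
  go (suc f) (suc m) = concatMap (λ j → map (suc j ∷_) (go f (m ∸ j))) (upTo (suc m))

compositions : ℕ → List (List ℕ)
compositions = compsAux

isArndt : List ℕ → Bool
isArndt [] = true
isArndt (x ∷ []) = true
isArndt (x ∷ y ∷ σ) = (y <ᵇ x) ∧ isArndt σ

lastPart : List ℕ → Maybe ℕ
lastPart = last

lastLe : ℕ → List ℕ → Bool
lastLe k σ with last σ
... | just x = x ≤ᵇ k
... | nothing = false

lastGe : ℕ → List ℕ → Bool
lastGe k σ with last σ
... | just x = k ≤ᵇ x
... | nothing = false

bLe : ℕ → ℕ → ℕ
bLe k n = length (filter (λ σ → Data.Bool.T? (isArndt σ ∧ lastLe k σ)) (compositions n))
  where import Data.Bool

bGe : ℕ → ℕ → ℕ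
bGe k n = length (filter (λ σ → Data.Bool.T? (isArndt σ ∧ lastGe k σ)) (compositions n))
  where import Data.Bool

module Submission where

-- Let T(n) count the Arndt compositions of n with last part at least k. Splitting off the first
-- part, the compositions headed by x + 1 are those headed by x together with those whose second
-- part is exactly x. Applying this to T, and once more to the compositions starting (y+1, y),
-- gives, for n ≥ 2,
--   T(n+2) + [n = k] = T(n+1) + T(n) + [n+1 = 2k] + [n+2 = k],
-- a recurrence that F(n-k) + F(n-2k) + [n = k] also satisfies, with the same values at n = 2, 3.
-- For k = 0 it is Fibonacci's recurrence, so F(n) counts all Arndt compositions of n, and
-- b^(≤k)(n) is the complement F(n) - b^(≥k+1)(n).

open import Defs
open import Algebra.Properties.CommutativeSemigroup using (interchange; x∙yz≈y∙xz)
open import Data.Bool using (Bool; true; false; _∧_; T?)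
open import Data.Bool.Properties using (∧-assoc)
open import Data.List
  using (List; []; _∷_; _++_; map; concat; concatMap; filter; length; upTo; applyUpTo; last)
open import Data.List.Properties using (concatMap-cong; map-upTo)
open import Data.Maybe using (just; nothing)
open import Data.Nat
open import Data.Nat.Properties
open import Data.Nat.Solver using (module +-*-Solver)
open import Data.Product using (Σ; _×_; _,_; proj₁)
open import Function using (_∘_)
open import Relation.Binary.PropositionalEquality

open +-*-Solver using (solve; _:+_; _:=_)

private
  +-+-interchange : ∀ a b c d → (a + b) + (c + d) ≡ (a + c) + (b + d)
  +-+-interchange = interchange +-commutativeSemigroup

  x*[y*z]≡y*[x*z] : ∀ x y z → x * (y * z) ≡ y * (x * z)
  x*[y*z]≡y*[x*z] = x∙yz≈y∙xz *-commutativeSemigroup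

-- `compositions` runs a fuelled helper local to a `where` block, which cannot be named; it is
-- recovered by unification, the `with` exposing it applied to variables only.
private
  compsAux-shape : Σ (ℕ → ℕ → List (List ℕ)) λ H →
    ∀ m → compsAux (suc m) ≡ concatMap (λ j → map (suc j ∷_) (H m j)) (upTo (suc m))
  compsAux-shape = _ , λ _ → refl

  record LocalHelper (go : ℕ → ℕ → List (List ℕ)) : Set where
    field agrees : ∀ m j → proj₁ compsAux-shape m j ≡ go m (m ∸ j)

  localHelper : LocalHelper _
  localHelper .LocalHelper.agrees m j with m ∸ j
  ... | _ = refl

  helperOf : ∀ {go} → LocalHelper go → ℕ → ℕ → List (List ℕ)
  helperOf {go} _ = go

  go : ℕ → ℕ → List (List ℕ)
  go = helperOf localHelper

  go-fuel-irrelevant : ∀ f g t → t ≤ f → t ≤ g → go f t ≡ go g t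
  go-fuel-irrelevant f g zero _ _ = refl
  go-fuel-irrelevant (suc f) (suc g) (suc t) (s≤s t≤f) (s≤s t≤g) =
    concatMap-cong (λ j → cong (map (suc j ∷_))
      (go-fuel-irrelevant f g (t ∸ j) (≤-trans (m∸n≤m t j) t≤f) (≤-trans (m∸n≤m t j) t≤g)))
      (upTo (suc t))

compositions-suc : ∀ m →
  compositions (suc m) ≡ concatMap (λ j → map (suc j ∷_) (compositions (m ∸ j))) (upTo (suc m))
compositions-suc m = concatMap-cong
  (λ j → cong (map (suc j ∷_)) (go-fuel-irrelevant m (m ∸ j) (m ∸ j) (m∸n≤m m j) ≤-refl))
  (upTo (suc m))

𝟙 : Bool → ℕ
𝟙 true = 1
𝟙 false = 0

private
  variable
    A B : Set

count : (A → Bool) → List A → ℕ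
count p xs = length (filter (T? ∘ p) xs)

count-∷ : ∀ p (x : A) xs → count p (x ∷ xs) ≡ 𝟙 (p x) + count p xs
count-∷ p x xs with p x
... | true = refl
... | false = refl

count-++ : ∀ p (xs ys : List A) → count p (xs ++ ys) ≡ count p xs + count p ys
count-++ p [] ys = refl
count-++ p (x ∷ xs) ys = begin
  count p (x ∷ xs ++ ys)              ≡⟨ count-∷ p x (xs ++ ys) ⟩
  𝟙 (p x) + count p (xs ++ ys)        ≡⟨ cong (𝟙 (p x) +_) (count-++ p xs ys) ⟩
  𝟙 (p x) + (count p xs + count p ys) ≡⟨ +-assoc (𝟙 (p x)) _ _ ⟨
  𝟙 (p x) + count p xs + count p ys   ≡⟨ cong (_+ count p ys) (count-∷ p x xs) ⟨
  count p (x ∷ xs) + count p ys       ∎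
  where open ≡-Reasoning

count-map : ∀ p (f : B → A) xs → count p (map f xs) ≡ count (p ∘ f) xs
count-map p f [] = refl
count-map p f (x ∷ xs) = begin
  count p (f x ∷ map f xs)         ≡⟨ count-∷ p (f x) (map f xs) ⟩
  𝟙 (p (f x)) + count p (map f xs) ≡⟨ cong (𝟙 (p (f x)) +_) (count-map p f xs) ⟩
  𝟙 (p (f x)) + count (p ∘ f) xs   ≡⟨ count-∷ (p ∘ f) x xs ⟨
  count (p ∘ f) (x ∷ xs)           ∎
  where open ≡-Reasoning

count-cong : ∀ {p q : A → Bool} → (∀ x → p x ≡ q x) → ∀ xs → count p xs ≡ count q xs
count-cong p≗q [] = refl
count-cong {p = p} {q} p≗q (x ∷ xs) = begin
  count p (x ∷ xs)         ≡⟨ count-∷ p x xs ⟩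
  𝟙 (p x) + count p xs     ≡⟨ cong₂ _+_ (cong 𝟙 (p≗q x)) (count-cong p≗q xs) ⟩
  𝟙 (q x) + count q xs     ≡⟨ count-∷ q x xs ⟨
  count q (x ∷ xs)         ∎
  where open ≡-Reasoning

count-∧ˡ : ∀ b (p : A → Bool) xs → count (λ x → b ∧ p x) xs ≡ 𝟙 b * count p xs
count-∧ˡ true p xs = sym (+-identityʳ _)
count-∧ˡ false p [] = refl
count-∧ˡ false p (x ∷ xs) = count-∧ˡ false p xs

count-+ : ∀ {p q r : A → Bool} → (∀ x → 𝟙 (p x) + 𝟙 (q x) ≡ 𝟙 (r x)) →
  ∀ xs → count p xs + count q xs ≡ count r xs
count-+ split [] = refl
count-+ {p = p} {q} {r} split (x ∷ xs) = begin
  count p (x ∷ xs) + count q (x ∷ xs)               ≡⟨ cong₂ _+_ (count-∷ p x xs) (count-∷ q x xs) ⟩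
  (𝟙 (p x) + count p xs) + (𝟙 (q x) + count q xs)   ≡⟨ +-+-interchange (𝟙 (p x)) _ _ _ ⟩
  (𝟙 (p x) + 𝟙 (q x)) + (count p xs + count q xs)   ≡⟨ cong₂ _+_ (split x) (count-+ split xs) ⟩
  𝟙 (r x) + count r xs                              ≡⟨ count-∷ r x xs ⟨
  count r (x ∷ xs)                                  ∎
  where open ≡-Reasoning

antidiag : ℕ → (ℕ → ℕ → ℕ) → ℕ
antidiag zero g = g 0 0
antidiag (suc n) g = g 0 (suc n) + antidiag n (λ j i → g (suc j) i)

antidiag-cong : ∀ n {g h : ℕ → ℕ → ℕ} → (∀ j i → g j i ≡ h j i) → antidiag n g ≡ antidiag n h
antidiag-cong zero g≗h = g≗h 0 0
antidiag-cong (suc n) g≗h = cong₂ _+_ (g≗h 0 (suc n)) (antidiag-cong n (λ j i → g≗h (suc j) i))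

antidiag-+ : ∀ n (g h : ℕ → ℕ → ℕ) → antidiag n (λ j i → g j i + h j i) ≡ antidiag n g + antidiag n h
antidiag-+ zero g h = refl
antidiag-+ (suc n) g h = trans
  (cong (g 0 (suc n) + h 0 (suc n) +_) (antidiag-+ n (λ j i → g (suc j) i) (λ j i → h (suc j) i)))
  (+-+-interchange (g 0 (suc n)) (h 0 (suc n)) _ _)

antidiag-0 : ∀ n → antidiag n (λ _ _ → 0) ≡ 0
antidiag-0 zero = refl
antidiag-0 (suc n) = antidiag-0 n

antidiag-suc-last : ∀ n (g : ℕ → ℕ → ℕ) →
  antidiag (suc n) g ≡ antidiag n (λ j i → g j (suc i)) + g (suc n) 0
antidiag-suc-last zero g = refl
antidiag-suc-last (suc n) g = trans
  (cong (g 0 (suc (suc n)) +_) (antidiag-suc-last n (λ j i → g (suc j) i)))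
  (sym (+-assoc (g 0 (suc (suc n))) _ _))

count-concat-applyUpTo : ∀ p m (g : ℕ → ℕ → List A) →
  count p (concat (applyUpTo (λ j → g j (m ∸ j)) (suc m))) ≡ antidiag m (λ j i → count p (g j i))
count-concat-applyUpTo p zero g = trans (count-++ p (g 0 0) []) (+-identityʳ _)
count-concat-applyUpTo p (suc m) g = trans (count-++ p (g 0 (suc m)) _)
  (cong (count p (g 0 (suc m)) +_) (count-concat-applyUpTo p m (λ j i → g (suc j) i)))

#comps : (List ℕ → Bool) → ℕ → ℕ
#comps p n = count p (compositions n)

#comps-0 : ∀ p → #comps p 0 ≡ 𝟙 (p [])
#comps-0 p = trans (count-∷ p [] []) (+-identityʳ _)

#comps-suc : ∀ p m → #comps p (suc m) ≡ antidiag m (λ j i → #comps (p ∘ (suc j ∷_)) i)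
#comps-suc p m = begin
  count p (compositions (suc m))
    ≡⟨ cong (count p) (trans (compositions-suc m) (cong concat (map-upTo _ (suc m)))) ⟩
  count p (concat (applyUpTo (λ j → map (suc j ∷_) (compositions (m ∸ j))) (suc m)))
    ≡⟨ count-concat-applyUpTo p m (λ j i → map (suc j ∷_) (compositions i)) ⟩
  antidiag m (λ j i → count p (map (suc j ∷_) (compositions i)))
    ≡⟨ antidiag-cong m (λ j i → count-map p (suc j ∷_) (compositions i)) ⟩
  antidiag m (λ j i → #comps (p ∘ (suc j ∷_)) i) ∎
  where open ≡-Reasoning

#comps-cong : ∀ {p q} → (∀ σ → p σ ≡ q σ) → ∀ n → #comps p n ≡ #comps q n
#comps-cong p≗q n = count-cong p≗q (compositions n)

lastGe-∷-∷ : ∀ k x y τ → lastGe k (x ∷ y ∷ τ) ≡ lastGe k (y ∷ τ)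
lastGe-∷-∷ k x y τ with last (y ∷ τ)
... | just _ = refl
... | nothing = refl

𝟙-<ᵇ-suc : ∀ y x → 𝟙 (y <ᵇ suc x) ≡ 𝟙 (y <ᵇ x) + 𝟙 (x ≡ᵇ y)
𝟙-<ᵇ-suc zero zero = refl
𝟙-<ᵇ-suc zero (suc x) = refl
𝟙-<ᵇ-suc (suc y) zero = refl
𝟙-<ᵇ-suc (suc y) (suc x) = 𝟙-<ᵇ-suc y x

𝟙-≤ᵇ-suc : ∀ k x → 𝟙 (k ≤ᵇ suc x) ≡ 𝟙 (k ≤ᵇ x) + 𝟙 (suc x ≡ᵇ k)
𝟙-≤ᵇ-suc zero x = refl
𝟙-≤ᵇ-suc (suc k) x = 𝟙-<ᵇ-suc k x

antidiag-pick-last : ∀ n (w : ℕ → ℕ) → antidiag n (λ j i → 𝟙 (i ≡ᵇ 0) * w j) ≡ w n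
antidiag-pick-last zero w = +-identityʳ (w 0)
antidiag-pick-last (suc n) w = antidiag-pick-last n (w ∘ suc)

𝟙-≡ᵇ-transport : ∀ a b (w : ℕ → ℕ) → 𝟙 (a ≡ᵇ b) * w b ≡ 𝟙 (b ≡ᵇ a) * w a
𝟙-≡ᵇ-transport zero zero w = refl
𝟙-≡ᵇ-transport zero (suc b) w = refl
𝟙-≡ᵇ-transport (suc a) zero w = refl
𝟙-≡ᵇ-transport (suc a) (suc b) w = 𝟙-≡ᵇ-transport a b (w ∘ suc)

superdiag : ℕ → (ℕ → ℕ) → ℕ
superdiag n w = antidiag n (λ j i → 𝟙 (i ≡ᵇ suc j) * w j)

superdiag-suc-suc : ∀ n w → superdiag (suc (suc n)) w ≡ superdiag n (w ∘ suc)
superdiag-suc-suc n w = trans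
  (cong (0 +_) (antidiag-suc-last n (λ j i → 𝟙 (i ≡ᵇ suc (suc j)) * w (suc j))))
  (+-identityʳ _)

superdiag-≡ᵇ : ∀ m k → superdiag m (λ j → 𝟙 (suc (suc j) ≡ᵇ k)) ≡ 𝟙 (3 + m ≡ᵇ k + k)
superdiag-≡ᵇ zero zero = refl
superdiag-≡ᵇ zero (suc zero) = refl
superdiag-≡ᵇ zero (suc (suc zero)) = refl
superdiag-≡ᵇ zero (suc (suc (suc k))) = sym (cong (λ s → 𝟙 (0 ≡ᵇ s)) (+-suc k _))
superdiag-≡ᵇ (suc zero) zero = refl
superdiag-≡ᵇ (suc zero) (suc zero) = refl
superdiag-≡ᵇ (suc zero) (suc (suc zero)) = refl
superdiag-≡ᵇ (suc zero) (suc (suc (suc k))) =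
  sym (cong (λ s → 𝟙 (1 ≡ᵇ s)) (trans (+-suc k _) (cong suc (+-suc k _))))
superdiag-≡ᵇ (suc (suc m)) zero = trans (superdiag-suc-suc m (λ j → 𝟙 (suc (suc j) ≡ᵇ 0)))
  (trans (antidiag-cong m (λ j i → *-zeroʳ (𝟙 (i ≡ᵇ suc j)))) (antidiag-0 m))
superdiag-≡ᵇ (suc (suc m)) (suc k) = begin
  superdiag (suc (suc m)) (λ j → 𝟙 (suc (suc j) ≡ᵇ suc k)) ≡⟨ superdiag-suc-suc m (λ j → 𝟙 (suc (suc j) ≡ᵇ suc k)) ⟩
  superdiag m (λ j → 𝟙 (suc (suc j) ≡ᵇ k))                 ≡⟨ superdiag-≡ᵇ m k ⟩
  𝟙 (3 + m ≡ᵇ k + k)                                       ≡⟨ cong (λ s → 𝟙 (5 + m ≡ᵇ suc s)) (+-suc k k) ⟨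
  𝟙 (5 + m ≡ᵇ suc k + suc k)                               ∎
  where open ≡-Reasoning

F-∸-suc-suc : ∀ a k → F (2 + a ∸ k) ≡ F (1 + a ∸ k) + F (a ∸ k) + 𝟙 (1 + a ≡ᵇ k)
F-∸-suc-suc a zero = sym (+-identityʳ _)
F-∸-suc-suc zero (suc zero) = refl
F-∸-suc-suc zero (suc (suc k)) = cong F (0∸n≡0 k)
F-∸-suc-suc (suc a) (suc k) = F-∸-suc-suc a k

-- The recurrence is stated with both sides moved so that no subtraction occurs.
recurrence-unique : (X Y a b : ℕ → ℕ) →
  (∀ m → X (4 + m) + a m ≡ X (3 + m) + X (2 + m) + b m) →
  (∀ m → Y (4 + m) + a m ≡ Y (3 + m) + Y (2 + m) + b m) →
  X 2 ≡ Y 2 → X 3 ≡ Y 3 → ∀ m → X (2 + m) ≡ Y (2 + m)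
recurrence-unique X Y a b recX recY eq₂ eq₃ m = proj₁ (pair m)
  where
  pair : ∀ m → X (2 + m) ≡ Y (2 + m) × X (3 + m) ≡ Y (3 + m)
  pair zero = eq₂ , eq₃
  pair (suc m) with pair m
  ... | eqₘ , eqₘ₊₁ = eqₘ₊₁ , +-cancelʳ-≡ (a m) (X (4 + m)) (Y (4 + m)) (begin
    X (4 + m) + a m                ≡⟨ recX m ⟩
    X (3 + m) + X (2 + m) + b m    ≡⟨ cong (_+ b m) (cong₂ _+_ eqₘ₊₁ eqₘ) ⟩
    Y (3 + m) + Y (2 + m) + b m    ≡⟨ recY m ⟨
    Y (4 + m) + a m                ∎)
    where open ≡-Reasoning

module LastAtLeast (k : ℕ) where

  counted : List ℕ → Bool
  counted σ = isArndt σ ∧ lastGe k σ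

  total : ℕ → ℕ
  total = #comps counted

  headed : ℕ → ℕ → ℕ
  headed x = #comps (counted ∘ (x ∷_))

  following : ℕ → ℕ → ℕ
  following y = #comps (λ τ → isArndt τ ∧ lastGe k (y ∷ τ))

  atK : ℕ → ℕ
  atK n = 𝟙 (n ≡ᵇ k)

  total-suc : ∀ m → total (suc m) ≡ antidiag m (λ j i → headed (suc j) i)
  total-suc = #comps-suc counted

  headed-0 : ∀ x → headed x 0 ≡ 𝟙 (k ≤ᵇ x)
  headed-0 x = #comps-0 (counted ∘ (x ∷_))

  headed-suc : ∀ x r → headed x (suc r) ≡ antidiag r (λ j i → 𝟙 (suc j <ᵇ x) * following (suc j) i)
  headed-suc x r = trans (#comps-suc _ r) (antidiag-cong r λ j i → trans
    (#comps-cong (λ τ → trans (cong (((suc j <ᵇ x) ∧ isArndt τ) ∧_) (lastGe-∷-∷ k x (suc j) τ))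
                               (∧-assoc (suc j <ᵇ x) (isArndt τ) _)) i)
    (count-∧ˡ (suc j <ᵇ x) (λ τ → isArndt τ ∧ lastGe k (suc j ∷ τ)) (compositions i)))

  following-0 : ∀ y → following y 0 ≡ 𝟙 (k ≤ᵇ y)
  following-0 y = #comps-0 (λ τ → isArndt τ ∧ lastGe k (y ∷ τ))

  following-suc : ∀ y s → following y (suc s) ≡ total (suc s)
  following-suc y s = trans (#comps-suc _ s) (trans
    (antidiag-cong s (λ j i → #comps-cong (λ τ → cong (isArndt (suc j ∷ τ) ∧_) (lastGe-∷-∷ k y (suc j) τ)) i))
    (sym (total-suc s)))

  following-raise : ∀ y s → following (suc y) s ≡ following y s + 𝟙 (s ≡ᵇ 0) * atK (suc y)
  following-raise y zero = begin
    following (suc y) 0             ≡⟨ following-0 (suc y) ⟩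
    𝟙 (k ≤ᵇ suc y)                  ≡⟨ 𝟙-≤ᵇ-suc k y ⟩
    𝟙 (k ≤ᵇ y) + atK (suc y)        ≡⟨ cong₂ _+_ (following-0 y) (+-identityʳ _) ⟨
    following y 0 + 1 * atK (suc y) ∎
    where open ≡-Reasoning
  following-raise y (suc s) = begin
    following (suc y) (suc s) ≡⟨ following-suc (suc y) s ⟩
    total (suc s)             ≡⟨ following-suc y s ⟨
    following y (suc s)       ≡⟨ +-identityʳ _ ⟨
    following y (suc s) + 0   ∎
    where open ≡-Reasoning

  -- What raising the head from x to x + 1 adds: the compositions whose second part is x,
  -- or the one-part composition when x + 1 = k.
  raised : ℕ → ℕ → ℕ
  raised x zero = atK (suc x)
  raised x (suc r) = antidiag r (λ j i → 𝟙 (x ≡ᵇ suc j) * following (suc j) i)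

  headed-raise : ∀ x r → headed (suc x) r ≡ headed x r + raised x r
  headed-raise x zero = begin
    headed (suc x) 0          ≡⟨ headed-0 (suc x) ⟩
    𝟙 (k ≤ᵇ suc x)            ≡⟨ 𝟙-≤ᵇ-suc k x ⟩
    𝟙 (k ≤ᵇ x) + atK (suc x)  ≡⟨ cong (_+ atK (suc x)) (headed-0 x) ⟨
    headed x 0 + raised x 0   ∎
    where open ≡-Reasoning
  headed-raise x (suc r) = begin
    headed (suc x) (suc r)
      ≡⟨ headed-suc (suc x) r ⟩
    antidiag r (λ j i → 𝟙 (suc j <ᵇ suc x) * following (suc j) i)
      ≡⟨ antidiag-cong r (λ j i → trans (cong (_* following (suc j) i) (𝟙-<ᵇ-suc (suc j) x))
                                        (*-distribʳ-+ (following (suc j) i) (𝟙 (suc j <ᵇ x)) (𝟙 (x ≡ᵇ suc j)))) ⟩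
    antidiag r (λ j i → 𝟙 (suc j <ᵇ x) * following (suc j) i + 𝟙 (x ≡ᵇ suc j) * following (suc j) i)
      ≡⟨ antidiag-+ r _ _ ⟩
    antidiag r (λ j i → 𝟙 (suc j <ᵇ x) * following (suc j) i) + raised x (suc r)
      ≡⟨ cong (_+ raised x (suc r)) (headed-suc x r) ⟨
    headed x (suc r) + raised x (suc r) ∎
    where open ≡-Reasoning

  -- The counted compositions of m + 2 whose first part exceeds the second by one, plus [m + 2 = k].
  tight : ℕ → ℕ
  tight m = antidiag m (λ j i → raised (suc j) i)

  total-suc-suc : ∀ m → total (2 + m) ≡ total (1 + m) + tight m
  total-suc-suc m = begin
    total (2 + m)
      ≡⟨ total-suc (suc m) ⟩
    headed 1 (suc m) + antidiag m (λ j i → headed (2 + j) i)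
      ≡⟨ cong (_+ antidiag m (λ j i → headed (2 + j) i)) (trans (headed-suc 1 m) (antidiag-0 m)) ⟩
    antidiag m (λ j i → headed (2 + j) i)
      ≡⟨ antidiag-cong m (λ j i → headed-raise (suc j) i) ⟩
    antidiag m (λ j i → headed (1 + j) i + raised (1 + j) i)
      ≡⟨ antidiag-+ m _ _ ⟩
    antidiag m (λ j i → headed (1 + j) i) + tight m
      ≡⟨ cong (_+ tight m) (total-suc m) ⟨
    total (1 + m) + tight m ∎
    where open ≡-Reasoning

  raised-1 : ∀ m → raised 1 (2 + m) ≡ total (1 + m)
  raised-1 m = begin
    raised 1 (2 + m)                                ≡⟨ cong₂ _+_ (+-identityʳ (following 1 (suc m))) (antidiag-0 m) ⟩
    following 1 (suc m) + 0                         ≡⟨ +-identityʳ _ ⟩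
    following 1 (suc m)                             ≡⟨ following-suc 1 m ⟩
    total (1 + m)                                   ∎
    where open ≡-Reasoning

  raised-lower : ∀ j i → raised (2 + j) (suc i) + 𝟙 (i ≡ᵇ 0) * atK (2 + j)
                       ≡ raised (1 + j) i + 𝟙 (i ≡ᵇ suc j) * atK (2 + j)
  raised-lower j zero = refl
  raised-lower j (suc i) = begin
    raised (2 + j) (2 + i) + 0
      ≡⟨ +-identityʳ _ ⟩
    antidiag i (λ a b → 𝟙 (j ≡ᵇ a) * following (2 + a) b)
      ≡⟨ antidiag-cong i (λ a b → trans (cong (𝟙 (j ≡ᵇ a) *_) (following-raise (suc a) b))
                                         (*-distribˡ-+ (𝟙 (j ≡ᵇ a)) _ _)) ⟩
    antidiag i (λ a b → 𝟙 (j ≡ᵇ a) * following (1 + a) b + 𝟙 (j ≡ᵇ a) * (𝟙 (b ≡ᵇ 0) * atK (2 + a)))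
      ≡⟨ antidiag-+ i _ _ ⟩
    raised (1 + j) (suc i) + antidiag i (λ a b → 𝟙 (j ≡ᵇ a) * (𝟙 (b ≡ᵇ 0) * atK (2 + a)))
      ≡⟨ cong (raised (1 + j) (suc i) +_) (begin
           antidiag i (λ a b → 𝟙 (j ≡ᵇ a) * (𝟙 (b ≡ᵇ 0) * atK (2 + a)))
             ≡⟨ antidiag-cong i (λ a b → x*[y*z]≡y*[x*z] (𝟙 (j ≡ᵇ a)) (𝟙 (b ≡ᵇ 0)) _) ⟩
           antidiag i (λ a b → 𝟙 (b ≡ᵇ 0) * (𝟙 (j ≡ᵇ a) * atK (2 + a)))
             ≡⟨ antidiag-pick-last i (λ a → 𝟙 (j ≡ᵇ a) * atK (2 + a)) ⟩
           𝟙 (j ≡ᵇ i) * atK (2 + i)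
             ≡⟨ 𝟙-≡ᵇ-transport j i (λ a → atK (2 + a)) ⟩
           𝟙 (i ≡ᵇ j) * atK (2 + j) ∎) ⟩
    raised (1 + j) (suc i) + 𝟙 (i ≡ᵇ j) * atK (2 + j) ∎
    where open ≡-Reasoning

  tight-suc-suc : ∀ m → tight (2 + m) + atK (2 + m)
                      ≡ total (1 + m) + tight m + superdiag m (λ j → atK (2 + j)) + atK (4 + m)
  tight-suc-suc m = begin
    tight (2 + m) + atK (2 + m)
      ≡⟨ cong (λ t → raised 1 (2 + m) + t + atK (2 + m)) (antidiag-suc-last m (λ j i → raised (2 + j) i)) ⟩
    raised 1 (2 + m) + (inner + atK (4 + m)) + atK (2 + m)
      ≡⟨ solve 4 (λ a b c d → a :+ (b :+ c) :+ d := a :+ (b :+ d) :+ c) refl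
               (raised 1 (2 + m)) inner (atK (4 + m)) (atK (2 + m)) ⟩
    raised 1 (2 + m) + (inner + atK (2 + m)) + atK (4 + m)
      ≡⟨ cong₂ (λ r t → r + t + atK (4 + m)) (raised-1 m) lowered ⟩
    total (1 + m) + (tight m + superdiag m (λ j → atK (2 + j))) + atK (4 + m)
      ≡⟨ cong (_+ atK (4 + m)) (+-assoc (total (1 + m)) _ _) ⟨
    total (1 + m) + tight m + superdiag m (λ j → atK (2 + j)) + atK (4 + m) ∎
    where
    open ≡-Reasoning
    inner : ℕ
    inner = antidiag m (λ j i → raised (2 + j) (suc i))
    lowered : inner + atK (2 + m) ≡ tight m + superdiag m (λ j → atK (2 + j))
    lowered = begin
      inner + atK (2 + m)
        ≡⟨ cong (inner +_) (antidiag-pick-last m (λ j → atK (2 + j))) ⟨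
      inner + antidiag m (λ j i → 𝟙 (i ≡ᵇ 0) * atK (2 + j))
        ≡⟨ antidiag-+ m _ _ ⟨
      antidiag m (λ j i → raised (2 + j) (suc i) + 𝟙 (i ≡ᵇ 0) * atK (2 + j))
        ≡⟨ antidiag-cong m raised-lower ⟩
      antidiag m (λ j i → raised (1 + j) i + 𝟙 (i ≡ᵇ suc j) * atK (2 + j))
        ≡⟨ antidiag-+ m _ _ ⟩
      tight m + superdiag m (λ j → atK (2 + j)) ∎

  total-rec : ∀ m → total (4 + m) + atK (2 + m)
                  ≡ total (3 + m) + total (2 + m) + (𝟙 (3 + m ≡ᵇ k + k) + atK (4 + m))
  total-rec m = begin
    total (4 + m) + atK (2 + m)
      ≡⟨ cong (_+ atK (2 + m)) (total-suc-suc (2 + m)) ⟩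
    total (3 + m) + tight (2 + m) + atK (2 + m)
      ≡⟨ +-assoc (total (3 + m)) _ _ ⟩
    total (3 + m) + (tight (2 + m) + atK (2 + m))
      ≡⟨ cong (total (3 + m) +_) (tight-suc-suc m) ⟩
    total (3 + m) + (total (1 + m) + tight m + diagonal + atK (4 + m))
      ≡⟨ cong (λ t → total (3 + m) + (t + diagonal + atK (4 + m))) (total-suc-suc m) ⟨
    total (3 + m) + (total (2 + m) + diagonal + atK (4 + m))
      ≡⟨ solve 4 (λ a b c d → a :+ (b :+ c :+ d) := a :+ b :+ (c :+ d)) refl
               (total (3 + m)) (total (2 + m)) diagonal (atK (4 + m)) ⟩
    total (3 + m) + total (2 + m) + (diagonal + atK (4 + m))
      ≡⟨ cong (λ t → total (3 + m) + total (2 + m) + (t + atK (4 + m))) (superdiag-≡ᵇ m k) ⟩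
    total (3 + m) + total (2 + m) + (𝟙 (3 + m ≡ᵇ k + k) + atK (4 + m)) ∎
    where
    open ≡-Reasoning
    diagonal : ℕ
    diagonal = superdiag m (λ j → atK (2 + j))

  total-2 : total 2 ≡ 𝟙 (k ≤ᵇ 1) + atK 2
  total-2 = trans (total-suc-suc 0) (cong (_+ atK 2) (trans (total-suc 0) (headed-0 1)))

  total-3 : total 3 ≡ 𝟙 (k ≤ᵇ 1) + atK 2 + (𝟙 (k ≤ᵇ 1) + atK 3)
  total-3 = trans (total-suc-suc 1)
    (cong₂ _+_ total-2 (cong (_+ atK 3) (trans (+-identityʳ (following 1 0)) (following-0 1))))

  closedForm : ℕ → ℕ
  closedForm n = F (n ∸ k) + F (n ∸ (k + k)) + atK n

  closedForm-rec : ∀ m → closedForm (4 + m) + atK (2 + m)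
                       ≡ closedForm (3 + m) + closedForm (2 + m) + (𝟙 (3 + m ≡ᵇ k + k) + atK (4 + m))
  closedForm-rec m = begin
    closedForm (4 + m) + atK (2 + m)
      ≡⟨ cong (_+ atK (2 + m)) (cong₂ (λ u v → u + v + atK (4 + m))
                                      (F-∸-suc-suc (2 + m) k) (F-∸-suc-suc (2 + m) (k + k))) ⟩
    (F₃ + F₂ + atK (3 + m)) + (G₃ + G₂ + δ) + atK (4 + m) + atK (2 + m)
      ≡⟨ solve 8 (λ F₃ F₂ a₃ G₃ G₂ δ a₄ a₂ →
                   (F₃ :+ F₂ :+ a₃) :+ (G₃ :+ G₂ :+ δ) :+ a₄ :+ a₂
                := (F₃ :+ G₃ :+ a₃) :+ (F₂ :+ G₂ :+ a₂) :+ (δ :+ a₄))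
               refl F₃ F₂ (atK (3 + m)) G₃ G₂ δ (atK (4 + m)) (atK (2 + m)) ⟩
    closedForm (3 + m) + closedForm (2 + m) + (δ + atK (4 + m)) ∎
    where
    open ≡-Reasoning
    F₃ F₂ G₃ G₂ δ : ℕ
    F₃ = F (3 + m ∸ k)
    F₂ = F (2 + m ∸ k)
    G₃ = F (3 + m ∸ (k + k))
    G₂ = F (2 + m ∸ (k + k))
    δ = 𝟙 (3 + m ≡ᵇ k + k)

module _ where
  open LastAtLeast

  total-2-closedForm : ∀ k → 1 ≤ k → total k 2 ≡ closedForm k 2
  total-2-closedForm (suc zero) _ = total-2 1
  total-2-closedForm (suc (suc zero)) _ = total-2 2
  total-2-closedForm (suc (suc (suc zero))) _ = total-2 3
  total-2-closedForm (suc (suc (suc (suc k)))) _ = total-2 (4 + k)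

  total-3-closedForm : ∀ k → 1 ≤ k → total k 3 ≡ closedForm k 3
  total-3-closedForm (suc zero) _ = total-3 1
  total-3-closedForm (suc (suc zero)) _ = total-3 2
  total-3-closedForm (suc (suc (suc zero))) _ = total-3 3
  total-3-closedForm (suc (suc (suc (suc k)))) _ = total-3 (4 + k)

  total-closedForm : ∀ k → 1 ≤ k → ∀ m → total k (2 + m) ≡ closedForm k (2 + m)
  total-closedForm k 1≤k = recurrence-unique (total k) (closedForm k) (λ m → atK k (2 + m))
    (λ m → 𝟙 (3 + m ≡ᵇ k + k) + atK k (4 + m)) (total-rec k) (closedForm-rec k)
    (total-2-closedForm k 1≤k) (total-3-closedForm k 1≤k)

  total-0 : ∀ m → total 0 (2 + m) ≡ F (2 + m)
  total-0 = recurrence-unique (total 0) F (λ _ → 0) (λ _ → 0) (total-rec 0) (λ _ → refl) refl refl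

𝟙-≡ᵇ-> : ∀ {m n} → n < m → 𝟙 (m ≡ᵇ n) ≡ 0
𝟙-≡ᵇ-> {suc m} {zero} _ = refl
𝟙-≡ᵇ-> {suc m} {suc n} (s≤s n<m) = 𝟙-≡ᵇ-> n<m

bGe-closed : ∀ {k n} → 1 ≤ k → k < n → bGe k n ≡ F (n ∸ k) + F (n ∸ 2 * k)
bGe-closed {suc k} {suc (suc m)} 1≤k k<n = begin
  LastAtLeast.total (suc k) (2 + m)
    ≡⟨ total-closedForm (suc k) 1≤k m ⟩
  F (2 + m ∸ suc k) + F (2 + m ∸ (suc k + suc k)) + 𝟙 (2 + m ≡ᵇ suc k)
    ≡⟨ cong (F (2 + m ∸ suc k) + F (2 + m ∸ (suc k + suc k)) +_) (𝟙-≡ᵇ-> k<n) ⟩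
  F (2 + m ∸ suc k) + F (2 + m ∸ (suc k + suc k)) + 0
    ≡⟨ +-identityʳ _ ⟩
  F (2 + m ∸ suc k) + F (2 + m ∸ (suc k + suc k))
    ≡⟨ cong (λ d → F (2 + m ∸ suc k) + F (2 + m ∸ (suc k + d))) (+-identityʳ (suc k)) ⟨
  F (2 + m ∸ suc k) + F (2 + m ∸ 2 * suc k) ∎
  where open ≡-Reasoning
bGe-closed {suc k} {suc zero} _ (s≤s ())

𝟙-<ᵇ-complement : ∀ x k → 𝟙 (x <ᵇ k) + 𝟙 (k <ᵇ suc x) ≡ 1
𝟙-<ᵇ-complement zero zero = refl
𝟙-<ᵇ-complement zero (suc k) = refl
𝟙-<ᵇ-complement (suc x) zero = refl
𝟙-<ᵇ-complement (suc x) (suc k) = 𝟙-<ᵇ-complement x k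

𝟙-≤ᵇ-complement : ∀ x k → 𝟙 (x ≤ᵇ k) + 𝟙 (suc k ≤ᵇ x) ≡ 1
𝟙-≤ᵇ-complement zero k = refl
𝟙-≤ᵇ-complement (suc x) k = 𝟙-<ᵇ-complement x k

bLe+bGe : ∀ k n → bLe k n + bGe (suc k) n ≡ bGe 0 n
bLe+bGe k n = count-+ split (compositions n)
  where
  split : ∀ σ → 𝟙 (isArndt σ ∧ lastLe k σ) + 𝟙 (isArndt σ ∧ lastGe (suc k) σ) ≡ 𝟙 (isArndt σ ∧ lastGe 0 σ)
  split σ with isArndt σ | last σ
  ... | false | _ = refl
  ... | true | just x = 𝟙-≤ᵇ-complement x k
  ... | true | nothing = refl

bLe-closed : ∀ {k n} → suc k < n → bLe k n + F (n ∸ suc k) + F (n ∸ 2 * suc k) ≡ F n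
bLe-closed {k} {suc (suc m)} sk<n = begin
  bLe k n + F (n ∸ suc k) + F (n ∸ 2 * suc k)   ≡⟨ +-assoc (bLe k n) _ _ ⟩
  bLe k n + (F (n ∸ suc k) + F (n ∸ 2 * suc k)) ≡⟨ cong (bLe k n +_) (bGe-closed (s≤s z≤n) sk<n) ⟨
  bLe k n + bGe (suc k) n                       ≡⟨ bLe+bGe k n ⟩
  LastAtLeast.total 0 n                         ≡⟨ total-0 m ⟩
  F n                                           ∎
  where
  open ≡-Reasoning
  n : ℕ
  n = 2 + m
bLe-closed {n = suc zero} (s≤s ())

corollary3p3 : (k n : ℕ) → 1 ≤ k → 2 * k + 2 ≤ n →
    (bLe k n + F (n ∸ (k + 1)) + F (n ∸ (2 * k + 2)) ≡ F n)
    × (bGe k n ≡ F (n ∸ k) + F (n ∸ 2 * k))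
corollary3p3 k n 1≤k 2k+2≤n =
  subst₂ (λ a b → bLe k n + F (n ∸ a) + F (n ∸ b) ≡ F n) (+-comm 1 k) 2[1+k]≡2k+2 (bLe-closed 2+k≤n) ,
  bGe-closed 1≤k (≤-trans (n≤1+n (suc k)) 2+k≤n)
  where
  2[1+k]≡2k+2 : 2 * suc k ≡ 2 * k + 2
  2[1+k]≡2k+2 = trans (*-distribˡ-+ 2 1 k) (+-comm 2 (2 * k))
  2+k≤n : 2 + k ≤ n
  2+k≤n = ≤-trans (≤-reflexive (+-comm 2 k)) (≤-trans (+-monoˡ-≤ 2 (m≤m+n k (k + 0))) 2k+2≤n)
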